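{- Let $n=p_1p_2p_3$ ($p_i$ distinct primes), $\gcd(n,6)=1$, $n>1000$, $G$ cyclic of order $n$, $\mathrm{ord}(g)=n$. Let $a,b,c$ be integers with $1+c=a+b$ and $1<c<\frac n2<n-b\le n-a<n-1$, such that $S=(g)\cdot(cg)\cdot((n-b)g)\cdot((n-a)g)$ is a reduced minimal zero-sum sequence and one of (A2), (A3), (A4) below holds. Let $s=\lfloor b/a\rfloor$ and assume $s\le9$ and condition (B). If the interval $[\frac nc,\frac nb]$ contains at least two integers, then $\mathrm{ind}(S)=1$.
   Context: Minimal zero-sum sequence: a finite unordered sequence of elements of $G$ whose terms sum to $0$ and no proper nonempty subsequence of which sums to $0$. $S$ is reduced if for every prime $p\mid n$ the sequence $(pg)\cdot(pcg)\cdot(p(n-b)g)\cdot(p(n-a)g)$ is not minimal zero-sum. For a generator $h$ of $G$, write $S=(m_1h)\cdots(m_4h)$ with $m_j\in[1,n]$, $\|S\|_h=(m_1+\cdots+m_4)/n$, $\mathrm{ind}(S)=\min\{\|S\|_h:\langle h\rangle=G\}$. Conditions (for a suitable labeling of the primes): (A2) $\{\gcd(c,n),\gcd(b,n),\gcd(a,n)\}=\{p_1,p_2,p_1p_2\}$; (A3) $\gcd(c+1,n)=p_1p_2$, $\gcd(b-1,n)=p_1p_3$, $\gcd(a-1,n)=p_2p_3$; (A4) $\gcd(c,n)=p_1p_2$, $\gcd(b,n)=p_1p_3$, $\gcd(a,n)=p_2p_3$. Condition (B): for every integer $t$ with $0\le t\le\lfloor s/2\rfloor-1$, the interval $[\frac{(2s-2t-1)n}{2b},\frac{(s-t)n}{b}]$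 contains no integer coprime to $n$. -}

module Defs where

open import Data.Nat using (ℕ; zero; suc; _+_; _*_; _∸_; _≤_; _<_; ∣_-_∣; _/_)
open import Data.Nat.Divisibility using (_∣_)
open import Data.Nat.GCD using (gcd)
open import Data.Nat.Coprimality using (Coprime)
open import Data.Nat.Primality using (Prime)
open import Data.Vec using (Vec; []; _∷_; sum)
open import Data.Fin.Subset using (Subset; Side; inside; outside; Nonempty) renaming (⊤ to full)
open import Data.List using (List) renaming ([] to []ˡ; _∷_ to _∷ˡ_)
open import Data.List.Membership.Propositional using (_∈_)
open import Data.List.Relation.Binary.Permutation.Propositional using (_↭_)
open import Data.Product using (_×_; ∃-syntax)
open import Data.Sum using (_⊎_)
open import Data.Unit using (⊤)
open import Function.Bundles using (_⇔_)
open import Relation.Nullary using (¬_)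
open import Relation.Binary.PropositionalEquality using (_≡_; _≢_)

-- G = ℤ/nℤ, elements represented by natural numbers; g = 1 (an element of order n).
-- Congruence modulo n:  x = y in G.
Congr : ℕ → ℕ → ℕ → Set
Congr n x y = n ∣ ∣ x - y ∣

subSum : ∀ {k} → Vec ℕ k → Subset k → ℕ
subSum []       []             = 0
subSum (x ∷ xs) (inside  ∷ p)  = x + subSum xs p
subSum (x ∷ xs) (outside ∷ p)  = subSum xs p

ZeroSum : ∀ {k} → ℕ → Vec ℕ k → Set
ZeroSum n xs = n ∣ sum xs

MinimalZeroSum : ∀ {k} → ℕ → Vec ℕ k → Set
MinimalZeroSum {k} n xs =
  ZeroSum n xs × (∀ (p : Subset k) → Nonempty p → p ≢ full → ¬ (n ∣ subSum xs p))

Generates : ℕ → ℕ → Set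
Generates n h = ∀ x → ∃[ t ] Congr n (t * h) x

Coeffs : ∀ {k} → ℕ → ℕ → Vec ℕ k → Vec ℕ k → Set
Coeffs n h []       []       = ⊤
Coeffs n h (x ∷ xs) (m ∷ ms) = (1 ≤ m × m ≤ n × Congr n (m * h) x) × Coeffs n h xs ms

-- ‖S‖_h = N / n
HasNormNumerator : ∀ {k} → ℕ → ℕ → Vec ℕ k → ℕ → Set
HasNormNumerator {k} n h xs N = ∃[ ms ] (Coeffs {k} n h xs ms × sum ms ≡ N)

-- ind(S) = min { ‖S‖_h : ⟨h⟩ = G } = 1
IndexIsOne : ∀ {k} → ℕ → Vec ℕ k → Set
IndexIsOne n xs =
  (∃[ h ] (Generates n h × HasNormNumerator n h xs n))
  × (∀ h → Generates n h → ∀ N → HasNormNumerator n h xs N → n ≤ N)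

seqS : ℕ → ℕ → ℕ → ℕ → Vec ℕ 4
seqS n a b c = 1 ∷ c ∷ (n ∸ b) ∷ (n ∸ a) ∷ []

Reduced : ℕ → ℕ → ℕ → ℕ → Set
Reduced n a b c = ∀ p → Prime p → p ∣ n →
  ¬ MinimalZeroSum n (p * 1 ∷ p * c ∷ p * (n ∸ b) ∷ p * (n ∸ a) ∷ [])

SameSet : List ℕ → List ℕ → Set
SameSet L R = ∀ x → (x ∈ L) ⇔ (x ∈ R)

list3 : ℕ → ℕ → ℕ → List ℕ
list3 x y z = x ∷ˡ y ∷ˡ z ∷ˡ []ˡ

CondA2 : ℕ → ℕ → ℕ → ℕ → ℕ → ℕ → ℕ → Set
CondA2 n a b c q1 q2 q3 = SameSet (list3 (gcd c n) (gcd b n) (gcd a n)) (list3 q1 q2 (q1 * q2))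

CondA3 : ℕ → ℕ → ℕ → ℕ → ℕ → ℕ → ℕ → Set
CondA3 n a b c q1 q2 q3 =
  gcd (c + 1) n ≡ q1 * q2 × gcd (b ∸ 1) n ≡ q1 * q3 × gcd (a ∸ 1) n ≡ q2 * q3

CondA4 : ℕ → ℕ → ℕ → ℕ → ℕ → ℕ → ℕ → Set
CondA4 n a b c q1 q2 q3 =
  gcd c n ≡ q1 * q2 × gcd b n ≡ q1 * q3 × gcd a n ≡ q2 * q3

CondA : ℕ → ℕ → ℕ → ℕ → ℕ → ℕ → ℕ → Set
CondA p1 p2 p3 n a b c = ∃[ q1 ] ∃[ q2 ] ∃[ q3 ]
  (list3 q1 q2 q3 ↭ list3 p1 p2 p3 ×
   (CondA2 n a b c q1 q2 q3 ⊎ CondA3 n a b c q1 q2 q3 ⊎ CondA4 n a b c q1 q2 q3))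

-- condition (B); x ∈ [(2s-2t-1)n/(2b), (s-t)n/b] written with denominators cleared (b > 0)
CondB : ℕ → ℕ → ℕ → Set
CondB n b s = ∀ t → t < s / 2 → ∀ x →
  (2 * s ∸ 2 * t ∸ 1) * n ≤ 2 * b * x → b * x ≤ (s ∸ t) * n → ¬ Coprime x n

-- [n/c, n/b] contains at least two integers (b, c > 0; the interval lies in the positive reals)
TwoIntegersIn : ℕ → ℕ → ℕ → Set
TwoIntegersIn n b c = ∃[ x ] ∃[ y ]
  (x < y × n ≤ c * x × b * x ≤ n × n ≤ c * y × b * y ≤ n)

module Submission where

-- Write g = 1 and let h = k⁻¹ for a unit k of ℤ/nℤ.  The terms
-- of S = 1 · c · (n−b) · (n−a) are k·h, (kc)·h, (k(n−b))·h, (k(n−a))·h, and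
-- when  n/c ≤ k ≤ n/b  the coefficients reduce to representatives
-- k, kc − n, n − kb, n − ka in [1, n] whose sum is exactly n; so ‖S‖_h = 1.
-- Conversely ‖S‖_h is a positive integer for every generator h, because S is
-- a zero-sum sequence.  Hence ind(S) = 1 as soon as such a unit k exists.
--
-- The unit is found among two consecutive integers x, x + 1 of [n/c, n/b].
-- Reducedness says that for each prime q ∣ n the zero-sum sequence qS has a
-- proper zero-sum subsequence; its sum is ≡ q·v with 1 ≤ v ≤ 2b, so
-- n ≤ 2bq.  If x and x + 1 both shared a prime with n, these bounds would
-- force x = P and x + 1 ∈ {P′, 2P′} for divisors P, P′ of n, which is
-- impossible for odd n.

open import Defs
open import Data.Nat using (ℕ; zero; suc; _+_; _*_; _∸_; _≤_; _<_; z≤n; s≤s; ∣_-_∣; >-nonZero; >-nonZero⁻¹)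
open import Data.Nat.Properties
open import Data.Nat.Divisibility
  using (_∣_; _∣?_; divides; ∣m+n∣m⇒∣n; ∣m∣n⇒∣m+n; n∣m*n; ∣⇒≤; ∣n⇒∣m*n; ∣m⇒∣m*n; ∣-refl; ∣-trans)
open import Data.Nat.Primality using (Prime; prime⇒irreducible; prime⇒nonZero)
open import Data.Nat.Coprimality using (Coprime; coprime?; coprime-divisor; coprime-Bézout)
open import Data.Nat.GCD using (module Bézout)
open import Data.Nat.Tactic.RingSolver using (solve-∀)
open import Data.Bool.Properties using () renaming (_≟_ to _≟ᵇ_)
open import Data.Fin using () renaming (zero to fzero; suc to fsuc)
open import Data.Vec using (Vec; []; _∷_; sum; there)
open import Data.Vec.Properties using (≡-dec)
open import Data.Fin.Subset using (Subset; inside; outside; Nonempty; _∈_; ⊤; ∁)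
open import Data.Fin.Subset.Properties using (anySubset?; nonempty?; ∈⊤; x∈p⇒x∉∁p)
open import Data.Product using (_×_; _,_; ∃-syntax; proj₁; proj₂)
open import Data.Sum using (_⊎_; inj₁; inj₂; [_,_])
open import Data.Empty using (⊥; ⊥-elim)
open import Data.Unit using (tt)
open import Relation.Nullary using (¬_; yes; no; ¬?)
open import Relation.Nullary.Decidable using (_×-dec_)
open import Relation.Binary.PropositionalEquality hiding ([_])

infix 4 _≈_[mod_]

-- x ≡ y (mod n), witnessed by multiples of n added to either side; this
-- form avoids truncated subtraction, so the ring solver does the bookkeeping.
data _≈_[mod_] (x y n : ℕ) : Set where
  shift : ∀ i j → x + i * n ≡ y + j * n → x ≈ y [mod n ]

≡⇒≈ : ∀ {n x y} → x ≡ y → x ≈ y [mod n ]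
≡⇒≈ refl = shift 0 0 refl

≈-sym : ∀ {n x y} → x ≈ y [mod n ] → y ≈ x [mod n ]
≈-sym (shift i j eq) = shift j i (sym eq)

≈-trans : ∀ {n x y z} → x ≈ y [mod n ] → y ≈ z [mod n ] → x ≈ z [mod n ]
≈-trans {n} {x} {y} {z} (shift i j x≈y) (shift i′ j′ y≈z) = shift (i + i′) (j′ + j) (begin
  x + (i + i′) * n       ≡⟨ split x i i′ n ⟩
  (x + i * n) + i′ * n   ≡⟨ cong (_+ i′ * n) x≈y ⟩
  (y + j * n) + i′ * n   ≡⟨ swap y j i′ n ⟩
  (y + i′ * n) + j * n   ≡⟨ cong (_+ j * n) y≈z ⟩
  (z + j′ * n) + j * n   ≡⟨ split z j′ j n ⟨
  z + (j′ + j) * n       ∎)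
  where
  open ≡-Reasoning
  split : ∀ x i i′ n → x + (i + i′) * n ≡ (x + i * n) + i′ * n
  split = solve-∀
  swap : ∀ y j i′ n → (y + j * n) + i′ * n ≡ (y + i′ * n) + j * n
  swap = solve-∀

≈-+ : ∀ {n x y u v} → x ≈ y [mod n ] → u ≈ v [mod n ] → x + u ≈ y + v [mod n ]
≈-+ {n} {x} {y} {u} {v} (shift i j x≈y) (shift i′ j′ u≈v) = shift (i + i′) (j + j′)
  (trans (regroup x u i i′ n) (trans (cong₂ _+_ x≈y u≈v) (sym (regroup y v j j′ n))))
  where
  regroup : ∀ x u i i′ n → x + u + (i + i′) * n ≡ (x + i * n) + (u + i′ * n)
  regroup = solve-∀

≈-*ˡ : ∀ {n x y} z → x ≈ y [mod n ] → z * x ≈ z * y [mod n ]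
≈-*ˡ {n} {x} {y} z (shift i j x≈y) = shift (z * i) (z * j)
  (trans (distrib z x i n) (trans (cong (z *_) x≈y) (sym (distrib z y j n))))
  where
  distrib : ∀ z x i n → z * x + z * i * n ≡ z * (x + i * n)
  distrib = solve-∀

≈-∣ : ∀ {n x y} → x ≈ y [mod n ] → n ∣ y → n ∣ x
≈-∣ {n} {x} (shift i j x≈y) n∣y = ∣m+n∣m⇒∣n n∣in+x (n∣m*n i)
  where
  n∣in+x : n ∣ i * n + x
  n∣in+x = subst (n ∣_) (trans (sym x≈y) (+-comm x (i * n))) (∣m∣n⇒∣m+n n∣y (n∣m*n j))

Congr-sym : ∀ {n} x y → Congr n x y → Congr n y x
Congr-sym {n} x y = subst (n ∣_) (∣-∣-comm x y)

≈⇒Congr-ordered : ∀ {n x y i j} → x + i * n ≡ y + j * n → i ≤ j → Congr n x y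
≈⇒Congr-ordered {n} {x} {y} {i} x≈y i≤j with m≤n⇒∃[o]m+o≡n i≤j
... | d , refl = divides d (begin
  ∣ x - y ∣           ≡⟨ cong (λ u → ∣ u - y ∣) x≡y+dn ⟩
  ∣ y + d * n - y ∣   ≡⟨ ∣-∣-comm (y + d * n) y ⟩
  ∣ y - y + d * n ∣   ≡⟨ ∣m-m+n∣≡n y (d * n) ⟩
  d * n               ∎)
  where
  open ≡-Reasoning
  regroup : ∀ y i d n → y + (i + d) * n ≡ y + d * n + i * n
  regroup = solve-∀
  x≡y+dn : x ≡ y + d * n
  x≡y+dn = +-cancelʳ-≡ (i * n) x (y + d * n) (trans x≈y (regroup y i d n))

≈⇒Congr : ∀ {n x y} → x ≈ y [mod n ] → Congr n x y
≈⇒Congr {x = x} {y} (shift i j x≈y) with ≤-total i j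
... | inj₁ i≤j = ≈⇒Congr-ordered x≈y i≤j
... | inj₂ j≤i = Congr-sym y x (≈⇒Congr-ordered (sym x≈y) j≤i)

Congr⇒≈-ordered : ∀ {n x y} → x ≤ y → Congr n x y → x ≈ y [mod n ]
Congr⇒≈-ordered {n} {x} {y} x≤y (divides q ∣x-y∣≡qn) = shift q 0 (begin
  x + q * n       ≡⟨ cong (x +_) (trans (sym ∣x-y∣≡qn) (m≤n⇒∣m-n∣≡n∸m x≤y)) ⟩
  x + (y ∸ x)     ≡⟨ m+[n∸m]≡n x≤y ⟩
  y               ≡⟨ +-identityʳ y ⟨
  y + 0 * n       ∎)
  where open ≡-Reasoning

Congr⇒≈ : ∀ {n} x y → Congr n x y → x ≈ y [mod n ]
Congr⇒≈ x y c with ≤-total x y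
... | inj₁ x≤y = Congr⇒≈-ordered x≤y c
... | inj₂ y≤x = ≈-sym (Congr⇒≈-ordered y≤x (Congr-sym x y c))

inverse : ∀ {n k} → 0 < n → Coprime k n → ∃[ h ] (k * h ≈ 1 [mod n ])
inverse {suc n′} {k} _ k⊥n with coprime-Bézout k⊥n
... | Bézout.Identity.+- x y 1+yn≡xk =
  x , shift 0 y (trans (+-identityʳ (k * x)) (trans (*-comm k x) (sym 1+yn≡xk)))
... | Bézout.Identity.-+ x y 1+xk≡yn =
  x * n′ , shift y (k * x) (trans (cong (k * (x * n′) +_) (sym 1+xk≡yn)) (regroup k x n′))
  where
  regroup : ∀ k x n′ → k * (x * n′) + (1 + x * k) ≡ 1 + k * x * suc n′
  regroup = solve-∀

cancel-inverse : ∀ {n m} k h x → k * h ≈ 1 [mod n ] → m ≈ k * x [mod n ] → m * h ≈ x [mod n ]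
cancel-inverse {m = m} k h x kh≈1 m≈kx =
  ≈-trans (≡⇒≈ (*-comm m h)) (≈-trans (≈-*ˡ h m≈kx)
    (≈-trans (≡⇒≈ (regroup h k x)) (≈-trans (≈-*ˡ x kh≈1) (≡⇒≈ (*-identityʳ x)))))
  where
  regroup : ∀ h k x → h * (k * x) ≡ x * (k * h)
  regroup = solve-∀

inverse⇒generates : ∀ {n} k h → k * h ≈ 1 [mod n ] → Generates n h
inverse⇒generates k h kh≈1 x = x * k , ≈⇒Congr (cancel-inverse k h x kh≈1 (≡⇒≈ (*-comm x k)))

coeffs-sum : ∀ {k n h} (xs ms : Vec ℕ k) → Coeffs n h xs ms → sum ms * h ≈ sum xs [mod n ]
coeffs-sum [] [] _ = ≡⇒≈ refl
coeffs-sum {h = h} (x ∷ xs) (m ∷ ms) ((_ , _ , mh≡x) , coeffs) =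
  ≈-trans (≡⇒≈ (*-distribʳ-+ h m (sum ms))) (≈-+ (Congr⇒≈ (m * h) x mh≡x) (coeffs-sum xs ms coeffs))

norm-integral : ∀ {k n h} {xs ms : Vec ℕ k} →
  Generates n h → ZeroSum n xs → Coeffs n h xs ms → n ∣ sum ms
norm-integral {n = n} {h} {xs} {ms} gen n∣Σxs coeffs with gen 1
... | t , th≡1 = ≈-∣ M≈M·th n∣M·th
  where
  M : ℕ
  M = sum ms
  n∣Mh : n ∣ M * h
  n∣Mh = ≈-∣ (coeffs-sum xs ms coeffs) n∣Σxs
  M≈M·th : M ≈ M * (t * h) [mod n ]
  M≈M·th = ≈-sym (≈-trans (≈-*ˡ M (Congr⇒≈ (t * h) 1 th≡1)) (≡⇒≈ (*-identityʳ M)))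
  regroup : ∀ t M h → t * (M * h) ≡ M * (t * h)
  regroup = solve-∀
  n∣M·th : n ∣ M * (t * h)
  n∣M·th = subst (n ∣_) (regroup t M h) (∣n⇒∣m*n t n∣Mh)

norm-lower-bound : ∀ {k n x} {xs : Vec ℕ k} → ZeroSum n (x ∷ xs) →
  ∀ h → Generates n h → ∀ N → HasNormNumerator n h (x ∷ xs) N → n ≤ N
norm-lower-bound {n = n} zs h gen N (m ∷ ms , coeffs@((1≤m , _) , _) , Σms≡N) =
  ∣⇒≤ ⦃ >-nonZero 0<N ⦄ (subst (n ∣_) Σms≡N (norm-integral gen zs coeffs))
  where
  0<N : 0 < N
  0<N = ≤-trans 1≤m (subst (m ≤_) Σms≡N (m≤m+n m (sum ms)))

positive-factor : ∀ {n c x} → 0 < n → n ≤ c * x → 0 < x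
positive-factor {c = c} {zero} 0<n n≤c·0 = ⊥-elim (<⇒≱ 0<n (≤-trans n≤c·0 (≤-reflexive (*-zeroʳ c))))
positive-factor {x = suc _} _ _ = s≤s z≤n

unit-multiple≢modulus : ∀ {n k w} → Coprime k n → w < n → k * w ≢ n
unit-multiple≢modulus {n} {k} {w} k⊥n w<n kw≡n
  with k⊥n (∣-refl , divides w (trans (sym kw≡n) (*-comm k w)))
... | refl = <-irrefl (trans (sym (+-identityʳ w)) kw≡n) w<n

excess≈ : ∀ {n} d w → d + n ≡ w → d ≈ w [mod n ]
excess≈ {n} d w d+n≡w = shift 1 0
  (trans (cong (d +_) (*-identityˡ n)) (trans d+n≡w (sym (+-identityʳ w))))

deficit≈ : ∀ {n} e k b T → e + k * b ≡ n → T + b ≡ n → e ≈ k * T [mod n ]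
deficit≈ {n} e k b T e+kb≡n T+b≡n = shift k 1 (begin
  e + k * n             ≡⟨ cong (λ u → e + k * u) T+b≡n ⟨
  e + k * (T + b)       ≡⟨ regroup e k T b ⟩
  (e + k * b) + k * T   ≡⟨ cong (_+ k * T) e+kb≡n ⟩
  n + k * T             ≡⟨ +-comm n (k * T) ⟩
  k * T + n             ≡⟨ cong (k * T +_) (*-identityˡ n) ⟨
  k * T + 1 * n         ∎)
  where
  open ≡-Reasoning
  regroup : ∀ e k T b → e + k * (T + b) ≡ (e + k * b) + k * T
  regroup = solve-∀

coefficient : ∀ {n m} k h x → k * h ≈ 1 [mod n ] → 1 ≤ m → m ≤ n → m ≈ k * x [mod n ] →
  1 ≤ m × m ≤ n × Congr n (m * h) x
coefficient k h x kh≈1 1≤m m≤n m≈kx = 1≤m , m≤n , ≈⇒Congr (cancel-inverse k h x kh≈1 m≈kx)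

representatives-sum : ∀ {n} a b c k d e f → 1 + c ≡ a + b →
  d + n ≡ k * c → e + k * b ≡ n → f + k * a ≡ n → k + (d + (e + (f + 0))) ≡ n
representatives-sum {n} a b c k d e f hc d+n≡kc e+kb≡n f+ka≡n =
  +-cancelʳ-≡ (n + k * b + k * a) _ _ (begin
    k + (d + (e + (f + 0))) + (n + k * b + k * a) ≡⟨ regroup k d e f n b a ⟩
    k + (d + n) + (e + k * b) + (f + k * a)       ≡⟨ cong₂ (λ u v → k + u + v + (f + k * a)) d+n≡kc e+kb≡n ⟩
    k + k * c + n + (f + k * a)                   ≡⟨ cong (k + k * c + n +_) f+ka≡n ⟩
    k + k * c + n + n                             ≡⟨ factor k c n ⟩
    k * (1 + c) + (n + n)                         ≡⟨ cong (λ u → k * u + (n + n)) hc ⟩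
    k * (a + b) + (n + n)                         ≡⟨ expand k a b n ⟩
    n + (n + k * b + k * a)                       ∎)
  where
  open ≡-Reasoning
  regroup : ∀ k d e f n b a →
    k + (d + (e + (f + 0))) + (n + k * b + k * a) ≡ k + (d + n) + (e + k * b) + (f + k * a)
  regroup = solve-∀
  factor : ∀ k c n → k + k * c + n + n ≡ k * (1 + c) + (n + n)
  factor = solve-∀
  expand : ∀ k a b n → k * (a + b) + (n + n) ≡ n + (n + k * b + k * a)
  expand = solve-∀

UnitInWindow : ℕ → ℕ → ℕ → ℕ → Set
UnitInWindow n b c k = Coprime k n × n ≤ c * k × b * k ≤ n

unit-in-window⇒norm-one : ∀ {n a b c} → 0 < n → ∃[ k ] UnitInWindow n b c k →
  1 + c ≡ a + b → 0 < b → a ≤ b → c < n → b < n →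
  ∃[ h ] (Generates n h × HasNormNumerator n h (seqS n a b c) n)
unit-in-window⇒norm-one {n} {a} {b} {c} 0<n (k , k⊥n , n≤ck , bk≤n) hc 0<b a≤b c<n b<n
  with inverse 0<n k⊥n
... | h , kh≈1 =
  h , inverse⇒generates k h kh≈1 , (k ∷ d ∷ e ∷ f ∷ []) ,
  (coefficient k h 1 kh≈1 1≤k k≤n (≡⇒≈ (sym (*-identityʳ k))) ,
   coefficient k h c kh≈1 1≤d d≤n (excess≈ d (k * c) d+n≡kc) ,
   coefficient k h (n ∸ b) kh≈1 (deficit-positive kb≤n b<n) (m∸n≤m n (k * b))
     (deficit≈ e k b (n ∸ b) e+kb≡n (m∸n+n≡m (<⇒≤ b<n))) ,
   coefficient k h (n ∸ a) kh≈1 (deficit-positive ka≤n a<n) (m∸n≤m n (k * a))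
     (deficit≈ f k a (n ∸ a) f+ka≡n (m∸n+n≡m (<⇒≤ a<n))) ,
   tt) ,
  representatives-sum a b c k d e f hc d+n≡kc e+kb≡n f+ka≡n
  where
  a<n : a < n
  a<n = ≤-<-trans a≤b b<n
  n≤kc : n ≤ k * c
  n≤kc = subst (n ≤_) (*-comm c k) n≤ck
  kb≤n : k * b ≤ n
  kb≤n = subst (_≤ n) (*-comm b k) bk≤n
  ka≤n : k * a ≤ n
  ka≤n = ≤-trans (*-monoʳ-≤ k a≤b) kb≤n
  d e f : ℕ
  d = k * c ∸ n
  e = n ∸ k * b
  f = n ∸ k * a
  d+n≡kc : d + n ≡ k * c
  d+n≡kc = m∸n+n≡m n≤kc
  e+kb≡n : e + k * b ≡ n
  e+kb≡n = m∸n+n≡m kb≤n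
  f+ka≡n : f + k * a ≡ n
  f+ka≡n = m∸n+n≡m ka≤n
  -- the representatives are nonzero because k·w ≠ n for w < n
  1≤d : 1 ≤ d
  1≤d = m<n⇒0<n∸m (≤∧≢⇒< n≤kc (λ n≡kc → unit-multiple≢modulus k⊥n c<n (sym n≡kc)))
  deficit-positive : ∀ {w} → k * w ≤ n → w < n → 1 ≤ n ∸ k * w
  deficit-positive kw≤n w<n = m<n⇒0<n∸m (≤∧≢⇒< kw≤n (unit-multiple≢modulus k⊥n w<n))
  1≤k : 1 ≤ k
  1≤k = positive-factor {c = c} 0<n n≤ck
  k≤n : k ≤ n
  k≤n = ≤-trans (m≤n*m k b ⦃ >-nonZero 0<b ⦄) bk≤n
  d≤n : d ≤ n
  d≤n = subst (d ≤_) (m+n∸n≡m n n) (∸-monoˡ-≤ n (begin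
    k * c             ≤⟨ *-monoʳ-≤ k (≤-trans (n≤1+n c) (subst (_≤ b + b) (sym hc) (+-monoˡ-≤ b a≤b))) ⟩
    k * (b + b)       ≡⟨ *-distribˡ-+ k b b ⟩
    k * b + k * b     ≤⟨ +-mono-≤ kb≤n kb≤n ⟩
    n + n             ∎))
    where open ≤-Reasoning

nonminimal⇒zero-subsum : ∀ {k n} {xs : Vec ℕ k} → ZeroSum n xs → ¬ MinimalZeroSum n xs →
  ∃[ p ] (Nonempty p × p ≢ ⊤ × n ∣ subSum xs p)
nonminimal⇒zero-subsum {n = n} {xs} zs ¬minimal
  with anySubset? (λ p → nonempty? p ×-dec ¬? (≡-dec _≟ᵇ_ p ⊤) ×-dec n ∣? subSum xs p)
... | yes found = found
... | no none = ⊥-elim (¬minimal (zs , λ p ne p≢⊤ n∣ → none (p , ne , p≢⊤ , n∣)))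

subSum-∁ : ∀ {k} (xs : Vec ℕ k) p → subSum xs p + subSum xs (∁ p) ≡ sum xs
subSum-∁ [] [] = refl
subSum-∁ (x ∷ xs) (inside ∷ p) = trans (+-assoc x _ _) (cong (x +_) (subSum-∁ xs p))
subSum-∁ (x ∷ xs) (outside ∷ p) = trans (x+[y+z]≡y+[x+z] (subSum xs p) x _) (cong (x +_) (subSum-∁ xs p))
  where
  x+[y+z]≡y+[x+z] : ∀ x y z → x + (y + z) ≡ y + (x + z)
  x+[y+z]≡y+[x+z] = solve-∀

-- a proper zero-sum subsequence may be taken to contain the first term:
-- otherwise its complement is one that does
zero-subsum-through-head : ∀ {k n x} {xs : Vec ℕ k} → ZeroSum n (x ∷ xs) →
  ∀ p → Nonempty p → p ≢ ⊤ → n ∣ subSum (x ∷ xs) p →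
  ∃[ p′ ] (p′ ≢ ⊤ × n ∣ subSum (x ∷ xs) (inside ∷ p′))
zero-subsum-through-head _ (inside ∷ p) _ p≢⊤ n∣ = p , (λ p≡⊤ → p≢⊤ (cong (inside ∷_) p≡⊤)) , n∣
zero-subsum-through-head _ (outside ∷ p) (fzero , ()) _ _
zero-subsum-through-head {n = n} {x} {xs} zs (outside ∷ p) (fsuc i , there i∈p) _ n∣ =
  ∁ p , ∁p≢⊤ , ∣m+n∣m⇒∣n (subst (n ∣_) (sym (subSum-∁ (x ∷ xs) (outside ∷ p))) zs) n∣
  where
  ∁p≢⊤ : ∁ p ≢ ⊤
  ∁p≢⊤ ∁p≡⊤ = x∈p⇒x∉∁p i∈p (subst (i ∈_) (sym ∁p≡⊤) ∈⊤)

SmallAnnihilator : ℕ → ℕ → ℕ → Set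
SmallAnnihilator n q b = ∃[ v ] (0 < v × v ≤ b + b × n ∣ q * v)

annihilator⇒bound : ∀ {n q b} → 0 < q → SmallAnnihilator n q b → n ≤ q * (b + b)
annihilator⇒bound {q = q} 0<q (v , 0<v , v≤2b , n∣qv) =
  ≤-trans (∣⇒≤ ⦃ m*n≢0 q v ⦃ >-nonZero 0<q ⦄ ⦃ >-nonZero 0<v ⦄ ⦄ n∣qv) (*-monoʳ-≤ q v≤2b)

excess⇒∣ : ∀ {n s} q r v → s ≡ q * (r * n) + q * v → n ∣ s → n ∣ q * v
excess⇒∣ {n} q r v eq n∣s = ∣m+n∣m⇒∣n (subst (n ∣_) eq n∣s) (∣n⇒∣m*n q (n∣m*n r))

deficit⇒∣ : ∀ {n s} q r v → s + q * v ≡ q * (r * n) → n ∣ s → n ∣ q * v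
deficit⇒∣ {n} q r v eq n∣s = ∣m+n∣m⇒∣n (subst (n ∣_) (sym eq) (∣n⇒∣m*n q (n∣m*n r))) n∣s

-- The scaled sequence qS, with S parametrised so that every term is a
-- polynomial:  a = 2 + a₀,  b = a + δ,  n = b + B,  c = a + b − 1;
-- then n − b = B and n − a = δ + B.
module ScaledSequence (q a₀ δ B : ℕ) where

  a b n c : ℕ
  a = 2 + a₀
  b = a + δ
  n = b + B
  c = suc a₀ + b

  qS : Vec ℕ 4
  qS = q * 1 ∷ q * c ∷ q * B ∷ q * (δ + B) ∷ []

  qS-zero-sum : ZeroSum n qS
  qS-zero-sum = divides (2 * q) (total q a₀ δ B)
    where
    total : ∀ q a₀ δ B →
      q * 1 + (q * (suc a₀ + (2 + a₀ + δ)) + (q * B + (q * (δ + B) + 0))) ≡ 2 * q * (2 + a₀ + δ + B)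
    total = solve-∀

  a≤b : a ≤ b
  a≤b = m≤m+n a δ

  b≤2b : b ≤ b + b
  b≤2b = m≤m+n b b

  a-1≤b : suc a₀ ≤ b
  a-1≤b = ≤-trans (n≤1+n (suc a₀)) a≤b

  -- Each proper subsum through the first term q is ≡ ± q·v with v one of
  -- 1, a + b, b − 1, a − 1, a, b, c; all these lie in [1, 2b].
  head-subsum⇒annihilator : ∀ p → p ≢ ⊤ → n ∣ subSum qS (inside ∷ p) → SmallAnnihilator n q b
  head-subsum⇒annihilator (outside ∷ outside ∷ outside ∷ []) _ n∣ =
    1 , s≤s z≤n , s≤s z≤n , subst (n ∣_) (+-identityʳ (q * 1)) n∣
  head-subsum⇒annihilator (inside ∷ outside ∷ outside ∷ []) _ n∣ =
    a + b , s≤s z≤n , +-monoˡ-≤ b a≤b , subst (n ∣_) (sum≡ q a₀ b) n∣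
    where
    sum≡ : ∀ q a₀ b → q * 1 + (q * (suc a₀ + b) + 0) ≡ q * (2 + a₀ + b)
    sum≡ = solve-∀
  head-subsum⇒annihilator (outside ∷ inside ∷ outside ∷ []) _ n∣ =
    suc (a₀ + δ) , s≤s z≤n , ≤-trans (n≤1+n (suc (a₀ + δ))) b≤2b ,
    deficit⇒∣ q 1 (suc (a₀ + δ)) (sum≡ q a₀ δ B) n∣
    where
    sum≡ : ∀ q a₀ δ B → q * 1 + (q * B + 0) + q * suc (a₀ + δ) ≡ q * (1 * (2 + a₀ + δ + B))
    sum≡ = solve-∀
  head-subsum⇒annihilator (outside ∷ outside ∷ inside ∷ []) _ n∣ =
    suc a₀ , s≤s z≤n , ≤-trans a-1≤b b≤2b , deficit⇒∣ q 1 (suc a₀) (sum≡ q a₀ δ B) n∣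
    where
    sum≡ : ∀ q a₀ δ B → q * 1 + (q * (δ + B) + 0) + q * suc a₀ ≡ q * (1 * (2 + a₀ + δ + B))
    sum≡ = solve-∀
  head-subsum⇒annihilator (inside ∷ inside ∷ outside ∷ []) _ n∣ =
    a , s≤s z≤n , ≤-trans a≤b b≤2b , excess⇒∣ q 1 a (sum≡ q a₀ b B) n∣
    where
    sum≡ : ∀ q a₀ b B → q * 1 + (q * (suc a₀ + b) + (q * B + 0)) ≡ q * (1 * (b + B)) + q * (2 + a₀)
    sum≡ = solve-∀
  head-subsum⇒annihilator (inside ∷ outside ∷ inside ∷ []) _ n∣ =
    b , s≤s z≤n , b≤2b , excess⇒∣ q 1 b (sum≡ q a₀ δ B) n∣
    where
    sum≡ : ∀ q a₀ δ B → q * 1 + (q * (suc a₀ + (2 + a₀ + δ)) + (q * (δ + B) + 0))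
                        ≡ q * (1 * (2 + a₀ + δ + B)) + q * (2 + a₀ + δ)
    sum≡ = solve-∀
  head-subsum⇒annihilator (outside ∷ inside ∷ inside ∷ []) _ n∣ =
    c , s≤s z≤n , +-monoˡ-≤ b a-1≤b , deficit⇒∣ q 2 c (sum≡ q a₀ δ B) n∣
    where
    sum≡ : ∀ q a₀ δ B → q * 1 + (q * B + (q * (δ + B) + 0)) + q * (suc a₀ + (2 + a₀ + δ))
                        ≡ q * (2 * (2 + a₀ + δ + B))
    sum≡ = solve-∀
  head-subsum⇒annihilator (inside ∷ inside ∷ inside ∷ []) p≢⊤ _ = ⊥-elim (p≢⊤ refl)

  nonminimal⇒bound : 0 < q → ¬ MinimalZeroSum n qS → n ≤ q * (b + b)
  nonminimal⇒bound 0<q ¬minimal with nonminimal⇒zero-subsum qS-zero-sum ¬minimal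
  ... | p , ne , p≢⊤ , n∣ with zero-subsum-through-head qS-zero-sum p ne p≢⊤ n∣
  ... | p′ , p′≢⊤ , n∣′ = annihilator⇒bound {b = b} 0<q (head-subsum⇒annihilator p′ p′≢⊤ n∣′)

reduced⇒prime-bound : ∀ {n a b c} → 2 ≤ a → a ≤ b → b < n → 1 + c ≡ a + b → Reduced n a b c →
  ∀ {q} → Prime q → q ∣ n → n ≤ q * (b + b)
reduced⇒prime-bound {n} {a} {b} {c} 2≤a a≤b b<n hc reduced {q} q-prime q∣n
  with m≤n⇒∃[o]m+o≡n 2≤a | m≤n⇒∃[o]m+o≡n a≤b | m≤n⇒∃[o]m+o≡n (<⇒≤ b<n)
... | a₀ , refl | δ , refl | B , refl with suc-injective hc
... | refl = ScaledSequence.nonminimal⇒bound q a₀ δ B (>-nonZero⁻¹ q ⦃ prime⇒nonZero q-prime ⦄)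
               (subst (λ v → ¬ MinimalZeroSum n v) qS≡ (reduced q q-prime q∣n))
  where
  n∸b≡B : n ∸ b ≡ B
  n∸b≡B = m+n∸m≡n b B
  n∸a≡δ+B : n ∸ a ≡ δ + B
  n∸a≡δ+B = trans (cong (_∸ a) (+-assoc a δ B)) (m+n∸m≡n a (δ + B))
  qS≡ : q * 1 ∷ q * c ∷ q * (n ∸ b) ∷ q * (n ∸ a) ∷ [] ≡ ScaledSequence.qS q a₀ δ B
  qS≡ = cong₂ (λ u v → q * 1 ∷ q * c ∷ q * u ∷ q * v ∷ []) n∸b≡B n∸a≡δ+B

coprime-6⇒odd : ∀ {n} → Coprime n 6 → ¬ 2 ∣ n
coprime-6⇒odd n⊥6 2∣n with n⊥6 (2∣n , divides 3 refl)
... | ()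

even-or-succ-even : ∀ m → 2 ∣ m ⊎ 2 ∣ suc m
even-or-succ-even zero = inj₁ (divides 0 refl)
even-or-succ-even (suc m) with even-or-succ-even m
... | inj₁ (divides t m≡2t) = inj₂ (divides (suc t) (cong (λ u → suc (suc u)) m≡2t))
... | inj₂ 2∣m+1 = inj₁ 2∣m+1

coprime-to-prime : ∀ {p z} → Prime p → ¬ p ∣ z → Coprime z p
coprime-to-prime p-prime p∤z (d∣z , d∣p) with prime⇒irreducible p-prime d∣p
... | inj₁ d≡1 = d≡1
... | inj₂ refl = ⊥-elim (p∤z d∣z)

coprime-*ʳ : ∀ {m n o} → Coprime m n → Coprime m o → Coprime m (n * o)
coprime-*ʳ m⊥n m⊥o (d∣m , d∣no) =
  m⊥o (d∣m , coprime-divisor (λ (e∣d , e∣n) → m⊥n (∣-trans e∣d d∣m , e∣n)) d∣no)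

common-prime-factor : ∀ {n p₁ p₂ p₃ z} → Prime p₁ → Prime p₂ → Prime p₃ → n ≡ p₁ * p₂ * p₃ →
  ¬ Coprime z n → ∃[ P ] (Prime P × P ∣ n × P ∣ z)
common-prime-factor {p₁ = p₁} {p₂} {p₃} {z} pr₁ pr₂ pr₃ refl ¬z⊥n
  with p₁ ∣? z | p₂ ∣? z | p₃ ∣? z
... | yes p₁∣z | _ | _ = p₁ , pr₁ , ∣m⇒∣m*n p₃ (∣m⇒∣m*n p₂ ∣-refl) , p₁∣z
... | no _ | yes p₂∣z | _ = p₂ , pr₂ , ∣m⇒∣m*n p₃ (n∣m*n p₁) , p₂∣z
... | no _ | no _ | yes p₃∣z = p₃ , pr₃ , n∣m*n (p₁ * p₂) , p₃∣z
... | no p₁∤z | no p₂∤z | no p₃∤z = ⊥-elim (¬z⊥n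
  (coprime-*ʳ (coprime-*ʳ (coprime-to-prime pr₁ p₁∤z) (coprime-to-prime pr₂ p₂∤z))
              (coprime-to-prime pr₃ p₃∤z)))

multiple-≤-double : ∀ {P m} → P ∣ m → 0 < m → m ≤ P + P → m ≡ P ⊎ m ≡ P + P
multiple-≤-double (divides zero refl) () _
multiple-≤-double {P} (divides 1 refl) _ _ = inj₁ (+-identityʳ P)
multiple-≤-double {P} (divides 2 refl) _ _ = inj₂ (cong (P +_) (+-identityʳ P))
multiple-≤-double {zero} (divides (suc (suc (suc t))) refl) 0<m _ =
  ⊥-elim (<-irrefl refl (subst (0 <_) (*-zeroʳ (3 + t)) 0<m))
multiple-≤-double {suc p} (divides (suc (suc (suc t))) refl) _ m≤2P =
  ⊥-elim (m+1+n≰m (suc p + suc p) (subst (_≤ suc p + suc p) (split t p) m≤2P))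
  where
  split : ∀ t p → (3 + t) * suc p ≡ (suc p + suc p) + suc (p + t * suc p)
  split = solve-∀

scaled-bound : ∀ {n b m P} → 0 < b → b * m ≤ n → n ≤ P * (b + b) → m ≤ P + P
scaled-bound {n} {b} {P = P} 0<b bm≤n n≤2bP =
  *-cancelˡ-≤ b ⦃ >-nonZero 0<b ⦄ (≤-trans bm≤n (subst (n ≤_) (swap P b) n≤2bP))
  where
  swap : ∀ P b → P * (b + b) ≡ b * (P + P)
  swap = solve-∀

consecutive-divisors : ∀ {x P P′} → 0 < x → P ∣ x → P′ ∣ suc x → suc x ≤ P + P → suc x ≤ P′ + P′ →
  x ≡ P × (suc x ≡ P′ ⊎ suc x ≡ P′ + P′)
consecutive-divisors {x} 0<x P∣x P′∣x+1 x+1≤2P x+1≤2P′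
  with multiple-≤-double P∣x 0<x (≤-trans (n≤1+n x) x+1≤2P)
... | inj₂ refl = ⊥-elim (<-irrefl refl x+1≤2P)
... | inj₁ x≡P = x≡P , multiple-≤-double P′∣x+1 (s≤s z≤n) x+1≤2P′

-- For odd n, x and x + 1 cannot have divisors P, P′ of n with n ≤ 2bP, 2bP′
-- when b(x + 1) ≤ n:  P and P + 1 would both be odd, or n = 2bP′ even.
no-consecutive-factors : ∀ {n b x P P′} → ¬ 2 ∣ n → 0 < b → 0 < x → b * suc x ≤ n →
  P ∣ n → P′ ∣ n → n ≤ P * (b + b) → n ≤ P′ * (b + b) → P ∣ x → P′ ∣ suc x → ⊥
no-consecutive-factors {n} {b} {x} {P} {P′} odd 0<b 0<x b[x+1]≤n P∣n P′∣n n≤2bP n≤2bP′ P∣x P′∣x+1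
  with consecutive-divisors 0<x P∣x P′∣x+1
         (scaled-bound {P = P} 0<b b[x+1]≤n n≤2bP) (scaled-bound {P = P′} 0<b b[x+1]≤n n≤2bP′)
... | refl , inj₁ P+1≡P′ =
  [ (λ 2∣P → odd (∣-trans 2∣P P∣n)) , (λ 2∣P+1 → odd (∣-trans (subst (2 ∣_) P+1≡P′ 2∣P+1) P′∣n)) ]
    (even-or-succ-even P)
... | _ , inj₂ x+1≡2P′ = odd (subst (2 ∣_) b[x+1]≡n (∣n⇒∣m*n b (divides P′ (trans x+1≡2P′ (double P′)))))
  where
  double : ∀ P′ → P′ + P′ ≡ P′ * 2
  double = solve-∀
  swap : ∀ P′ b → P′ * (b + b) ≡ b * (P′ + P′)
  swap = solve-∀
  b[x+1]≡n : b * suc x ≡ n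
  b[x+1]≡n = ≤-antisym b[x+1]≤n
    (≤-trans n≤2bP′ (≤-reflexive (trans (swap P′ b) (cong (b *_) (sym x+1≡2P′)))))

consecutive-unit : ∀ {n p₁ p₂ p₃ b x} → Prime p₁ → Prime p₂ → Prime p₃ → n ≡ p₁ * p₂ * p₃ →
  ¬ 2 ∣ n → (∀ {q} → Prime q → q ∣ n → n ≤ q * (b + b)) → 0 < b → 0 < x → b * suc x ≤ n →
  Coprime x n ⊎ Coprime (suc x) n
consecutive-unit {n} {x = x} pr₁ pr₂ pr₃ n≡p₁p₂p₃ odd prime-bound 0<b 0<x b[x+1]≤n
  with coprime? x n | coprime? (suc x) n
... | yes x⊥n | _ = inj₁ x⊥n
... | no _ | yes x+1⊥n = inj₂ x+1⊥n
... | no ¬x⊥n | no ¬x+1⊥n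
  with common-prime-factor pr₁ pr₂ pr₃ n≡p₁p₂p₃ ¬x⊥n | common-prime-factor pr₁ pr₂ pr₃ n≡p₁p₂p₃ ¬x+1⊥n
... | P , P-prime , P∣n , P∣x | P′ , P′-prime , P′∣n , P′∣x+1 =
  ⊥-elim (no-consecutive-factors odd 0<b 0<x b[x+1]≤n P∣n P′∣n
           (prime-bound P-prime P∣n) (prime-bound P′-prime P′∣n) P∣x P′∣x+1)

window-unit : ∀ {n p₁ p₂ p₃ b c x} → Prime p₁ → Prime p₂ → Prime p₃ → n ≡ p₁ * p₂ * p₃ →
  ¬ 2 ∣ n → (∀ {q} → Prime q → q ∣ n → n ≤ q * (b + b)) → 0 < n → 0 < b →
  n ≤ c * x → b * suc x ≤ n → ∃[ k ] UnitInWindow n b c k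
window-unit {b = b} {c} {x} pr₁ pr₂ pr₃ n≡p₁p₂p₃ odd prime-bound 0<n 0<b n≤cx b[x+1]≤n
  with consecutive-unit pr₁ pr₂ pr₃ n≡p₁p₂p₃ odd prime-bound 0<b (positive-factor {c = c} 0<n n≤cx) b[x+1]≤n
... | inj₁ x⊥n = x , x⊥n , n≤cx , ≤-trans (*-monoʳ-≤ b (n≤1+n x)) b[x+1]≤n
... | inj₂ x+1⊥n = suc x , x+1⊥n , ≤-trans n≤cx (*-monoʳ-≤ c (n≤1+n x)) , b[x+1]≤n

positive-half : ∀ {n m} → n < 2 * m → 0 < m
positive-half {m = suc _} _ = s≤s z≤n

ordering : ∀ {n} a b → n < 2 * (n ∸ b) → n ∸ b ≤ n ∸ a → n ∸ a < n ∸ 1 → 2 ≤ a × a ≤ b × b < n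
ordering {n} a b n<2[n-b] n-b≤n-a n-a<n-1 =
  ∸-cancelʳ-< n-a<n-1 , ∸-cancelʳ-≤ (<⇒≤ a<n) n-b≤n-a , b<n
  where
  below : ∀ {m} → 0 < n ∸ m → m < n
  below {m} 0<n-m = ∸-cancelʳ-< (subst (_< n ∸ m) (sym (n∸n≡0 n)) 0<n-m)
  0<n-b : 0 < n ∸ b
  0<n-b = positive-half n<2[n-b]
  b<n : b < n
  b<n = below 0<n-b
  a<n : a < n
  a<n = below (≤-trans 0<n-b n-b≤n-a)

lemma4p1 : ∀ (p1 p2 p3 n : ℕ) → Prime p1 → Prime p2 → Prime p3 →
    p1 ≢ p2 → p1 ≢ p3 → p2 ≢ p3 → n ≡ p1 * p2 * p3 →
    Coprime n 6 → 1000 < n →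
    ∀ (a b c : ℕ) → 1 + c ≡ a + b →
    1 < c → 2 * c < n → n < 2 * (n ∸ b) → n ∸ b ≤ n ∸ a → n ∸ a < n ∸ 1 →
    MinimalZeroSum n (seqS n a b c) → Reduced n a b c →
    CondA p1 p2 p3 n a b c →
    ∀ (s : ℕ) → s * a ≤ b → b < suc s * a → s ≤ 9 →
    CondB n b s →
    TwoIntegersIn n b c →
    IndexIsOne n (seqS n a b c)
lemma4p1 p1 p2 p3 n pr₁ pr₂ pr₃ _ _ _ n≡p₁p₂p₃ n⊥6 1000<n a b c hc _ 2c<n n<2[n-b] n-b≤n-a n-a<n-1
  minimal reduced _ _ _ _ _ _ (x , y , x<y , n≤cx , _ , _ , by≤n) =
  unit-in-window⇒norm-one 0<n unit hc 0<b a≤b c<n b<n , norm-lower-bound (proj₁ minimal)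
  where
  order : 2 ≤ a × a ≤ b × b < n
  order = ordering a b n<2[n-b] n-b≤n-a n-a<n-1
  2≤a : 2 ≤ a
  2≤a = proj₁ order
  a≤b : a ≤ b
  a≤b = proj₁ (proj₂ order)
  b<n : b < n
  b<n = proj₂ (proj₂ order)
  0<b : 0 < b
  0<b = ≤-trans (≤-trans (s≤s z≤n) 2≤a) a≤b
  0<n : 0 < n
  0<n = ≤-trans (s≤s z≤n) 1000<n
  c<n : c < n
  c<n = ≤-<-trans (m≤m+n c (c + 0)) 2c<n
  unit : ∃[ k ] UnitInWindow n b c k
  unit = window-unit {c = c} pr₁ pr₂ pr₃ n≡p₁p₂p₃ (coprime-6⇒odd n⊥6)
           (reduced⇒prime-bound 2≤a a≤b b<n hc reduced) 0<n 0<b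
           n≤cx (≤-trans (*-monoʳ-≤ b x<y) by≤n)
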